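{- Let $n$ be a positive integer and $\{A_m\}_{m\ge0}$ a sequence. If $\{A_m\}$ is an even sequence and $n$ is odd, or if $\{A_m\}$ is an odd sequence and $n$ is even, then $$\sum_{\substack{k=0\\ 3\mid k}}^n\binom nkA_{n-k}=\sum_{\substack{k=0\\ 3\mid n-k}}^n\binom nkA_k=\frac13\sum_{k=0}^n\binom nkA_k.$$
   Context: A sequence $\{a_n\}_{n\ge0}$ of real (or complex) numbers is called an even sequence if $\sum_{k=0}^n\binom nk(-1)^ka_k=a_n$ for all $n=0,1,2,\ldots$, and an odd sequence if $\sum_{k=0}^n\binom nk(-1)^ka_k=-a_n$ for all $n=0,1,2,\ldots$. -}

module Defs where

open import Level using (Level)
open import Algebra.Bundles using (CommutativeRing)
open import Data.Nat using (ℕ; zero; suc; _∸_)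
open import Data.Nat.Combinatorics using (_C_)
open import Data.Nat.Divisibility using (_∣?_)
open import Data.Product using (Σ)
open import Relation.Nullary using (yes; no)

module _ {c ℓ : Level} (R : CommutativeRing c ℓ) where
  open CommutativeRing R

  _·_ : ℕ → Carrier → Carrier
  zero  · x = 0#
  suc n · x = x + (n · x)

  negOnePow : ℕ → Carrier
  negOnePow zero    = 1#
  negOnePow (suc k) = (- 1#) * negOnePow k

  sumTo : ℕ → (ℕ → Carrier) → Carrier
  sumTo zero    f = f 0
  sumTo (suc n) f = sumTo n f + f (suc n)

  if3∣ : ℕ → Carrier → Carrier
  if3∣ m x with 3 ∣? m
  ... | yes _ = x
  ... | no  _ = 0#

  binomNegSum : (ℕ → Carrier) → ℕ → Carrier
  binomNegSum a n = sumTo n (λ k → (n C k) · (negOnePow k * a k))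

  IsEvenSeq : (ℕ → Carrier) → Set ℓ
  IsEvenSeq a = ∀ n → binomNegSum a n ≈ a n

  IsOddSeq : (ℕ → Carrier) → Set ℓ
  IsOddSeq a = ∀ n → binomNegSum a n ≈ - a n

  -- R is a ℚ-algebra: every positive integer m+1 is invertible in R
  QAlgebraInverses : Set (Level._⊔_ c ℓ)
  QAlgebraInverses = (m : ℕ) → Σ Carrier (λ y → ((suc m) · 1#) * y ≈ 1#)

module Submission where

-- The proof uses the binomial convolution (f ⋆ g)(n) = Σ C(n,k) f(n-k) g(k),
-- which is associative (via the Leibniz rule), and the 3-periodic sequence
-- χ = (2, -1, -1, 2, -1, -1, …), so that χ(m) + 1 = 3·[3 ∣ m].  Thus
--   3 · (restricted sum) = (χ ⋆ A)(n) + (full sum),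
-- and it suffices to show (χ ⋆ A)(n) = 0.  Write the hypothesis on A as
-- A = e · (1 ⋆ twist A) with twist A (k) = (-1)^k A(k), where e = ±1 and
-- e (-1)^n = -1.  Since the consecutive triples of χ sum to zero and
-- χ(2m) = χ(m), we get χ ⋆ 1 = twist χ; by associativity
--   χ ⋆ A = e · (twist χ ⋆ twist A) = e (-1)^n · (χ ⋆ A) = -(χ ⋆ A)
-- at n, and (χ ⋆ A)(n) = 0 because 2 is invertible.

open import Defs
open import Level using (Level)
open import Algebra.Bundles using (CommutativeRing)
open import Data.Nat as ℕ using (ℕ; zero; suc; _∸_; _≤_; _%_; z≤n; s≤s)
import Data.Nat.Properties as ℕ
open import Data.Nat.Combinatorics using (_C_; nCk+nC[k+1]≡[n+1]C[k+1]; k>n⇒nCk≡0; nCk≡nC[n∸k])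
open import Data.Nat.Divisibility using (_∣_; _∣?_; _∣0; ∣⇒≤; ∣m∣n⇒∣m+n; ∣m+n∣m⇒∣n; ∣-refl)
open import Data.Product using (_×_; proj₁; proj₂; _,_; Σ)
open import Data.Sum using (_⊎_; inj₁; inj₂)
open import Data.Empty using (⊥-elim)
open import Relation.Nullary using (¬_; yes; no)
open import Relation.Binary.PropositionalEquality as ≡ using (_≡_)

module BinomialConvolution {c ℓ : Level} (R : CommutativeRing c ℓ) where
  open CommutativeRing R
  open import Relation.Binary.Reasoning.Setoid setoid
  open import Algebra.Properties.Ring ring
    using (-1*x≈-x; -‿distribˡ-*; -‿distribʳ-*; -‿involutive; +-inverseˡ-unique)
  open import Algebra.Properties.Semiring.Mult semiring
    using (×-congʳ; ×-homo-1; ×-homo-+; ×-comm-*; ×-assoc-*) renaming (_×_ to _⋅_)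
  open import Algebra.Properties.CommutativeMonoid.Mult +-commutativeMonoid
    using (×-distrib-+)
  open import Algebra.Properties.CommutativeSemigroup +-commutativeSemigroup
    using () renaming (interchange to +-interchange)
  open import Algebra.Properties.CommutativeSemigroup *-commutativeSemigroup
    using () renaming (interchange to *-interchange; x∙yz≈y∙xz to *-leftComm)

  Seq : Set c
  Seq = ℕ → Carrier

  ·≈⋅ : ∀ m x → _·_ R m x ≈ m ⋅ x
  ·≈⋅ zero    x = refl
  ·≈⋅ (suc m) x = +-congˡ (·≈⋅ m x)

  ⋅1#-* : ∀ m x → (m ⋅ 1#) * x ≈ m ⋅ x
  ⋅1#-* m x = trans (×-assoc-* m 1# x) (×-congʳ m (*-identityˡ x))

  divide : ∀ m {y x s} → (m ⋅ 1#) * y ≈ 1# → (m ⋅ 1#) * x ≈ s → x ≈ y * s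
  divide m {y} {x} {s} my≈1 mx≈s = begin
    x                  ≈⟨ *-identityˡ x ⟨
    1# * x             ≈⟨ *-congʳ (trans (*-comm y _) my≈1) ⟨
    (y * (m ⋅ 1#)) * x ≈⟨ *-assoc y _ x ⟩
    y * ((m ⋅ 1#) * x) ≈⟨ *-congˡ mx≈s ⟩
    y * s              ∎

  self-negative⇒0 : ∀ {y x} → (2 ⋅ 1#) * y ≈ 1# → x ≈ - x → x ≈ 0#
  self-negative⇒0 {y} {x} 2y≈1 x≈-x = trans (divide 2 2y≈1 2x≈0) (zeroʳ y)
    where
    2x≈0 : (2 ⋅ 1#) * x ≈ 0#
    2x≈0 = begin
      (2 ⋅ 1#) * x ≈⟨ ⋅1#-* 2 x ⟩
      x + (x + 0#) ≈⟨ +-cong x≈-x (+-identityʳ x) ⟩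
      - x + x      ≈⟨ -‿inverseˡ x ⟩
      0#           ∎

  sum : ℕ → Seq → Carrier
  sum = sumTo R

  sum-cong : ∀ n {f g : Seq} → (∀ k → k ≤ n → f k ≈ g k) → sum n f ≈ sum n g
  sum-cong zero    f≈g = f≈g 0 z≤n
  sum-cong (suc n) f≈g =
    +-cong (sum-cong n (λ k k≤n → f≈g k (ℕ.m≤n⇒m≤1+n k≤n))) (f≈g (suc n) ℕ.≤-refl)

  sum-cong′ : ∀ n {f g : Seq} → (∀ k → f k ≈ g k) → sum n f ≈ sum n g
  sum-cong′ n f≈g = sum-cong n (λ k _ → f≈g k)

  sum-+ : ∀ n (f g : Seq) → sum n (λ k → f k + g k) ≈ sum n f + sum n g
  sum-+ zero    f g = refl
  sum-+ (suc n) f g = trans (+-congʳ (sum-+ n f g)) (+-interchange _ _ _ _)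

  sum-*ˡ : ∀ n x (f : Seq) → x * sum n f ≈ sum n (λ k → x * f k)
  sum-*ˡ zero    x f = refl
  sum-*ˡ (suc n) x f = trans (distribˡ x _ _) (+-congʳ (sum-*ˡ n x f))

  sum-head : ∀ n (f : Seq) → sum (suc n) f ≈ f 0 + sum n (λ k → f (suc k))
  sum-head zero    f = refl
  sum-head (suc n) f = trans (+-congʳ (sum-head n f)) (+-assoc _ _ _)

  sum-reverse : ∀ n (f : Seq) → sum n f ≈ sum n (λ k → f (n ∸ k))
  sum-reverse zero    f = refl
  sum-reverse (suc n) f = begin
    sum n f + f (suc n)                   ≈⟨ +-comm _ _ ⟩
    f (suc n) + sum n f                   ≈⟨ +-congˡ (sum-reverse n f) ⟩
    f (suc n) + sum n (λ k → f (n ∸ k))   ≈⟨ sum-head n (λ k → f (suc n ∸ k)) ⟨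
    sum (suc n) (λ k → f (suc n ∸ k))     ∎

  sum-pascal : ∀ n (t : Seq) →
    sum (suc n) (λ k → (suc n C k) ⋅ t k)
      ≈ sum n (λ k → (n C k) ⋅ t k) + sum n (λ k → (n C k) ⋅ t (suc k))
  sum-pascal n t = begin
    sum (suc n) (λ k → (suc n C k) ⋅ t k)
      ≈⟨ sum-head n _ ⟩
    1 ⋅ t 0 + sum n (λ k → (suc n C suc k) ⋅ t (suc k))
      ≈⟨ +-congˡ (sum-cong′ n split) ⟩
    1 ⋅ t 0 + sum n (λ k → (n C suc k) ⋅ t (suc k) + (n C k) ⋅ t (suc k))
      ≈⟨ +-congˡ (sum-+ n _ _) ⟩
    1 ⋅ t 0 + (D + B)
      ≈⟨ +-assoc _ D B ⟨
    (1 ⋅ t 0 + D) + B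
      ≈⟨ +-congʳ unshift ⟩
    sum n (λ k → (n C k) ⋅ t k) + B ∎
    where
    B D : Carrier
    B = sum n (λ k → (n C k) ⋅ t (suc k))
    D = sum n (λ k → (n C suc k) ⋅ t (suc k))
    split : ∀ k → (suc n C suc k) ⋅ t (suc k)
                    ≈ (n C suc k) ⋅ t (suc k) + (n C k) ⋅ t (suc k)
    split k = begin
      (suc n C suc k) ⋅ t (suc k)
        ≈⟨ reflexive (≡.cong (_⋅ t (suc k)) (≡.sym (nCk+nC[k+1]≡[n+1]C[k+1] n k))) ⟩
      (n C k ℕ.+ n C suc k) ⋅ t (suc k)
        ≈⟨ ×-homo-+ _ (n C k) (n C suc k) ⟩
      (n C k) ⋅ t (suc k) + (n C suc k) ⋅ t (suc k)
        ≈⟨ +-comm _ _ ⟩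
      (n C suc k) ⋅ t (suc k) + (n C k) ⋅ t (suc k) ∎
    -- the top term C(n, n+1) t(n+1) vanishes
    unshift : 1 ⋅ t 0 + D ≈ sum n (λ k → (n C k) ⋅ t k)
    unshift = begin
      1 ⋅ t 0 + D
        ≈⟨ sum-head n (λ k → (n C k) ⋅ t k) ⟨
      sum n (λ k → (n C k) ⋅ t k) + (n C suc n) ⋅ t (suc n)
        ≈⟨ +-congˡ (reflexive (≡.cong (_⋅ t (suc n)) (k>n⇒nCk≡0 (ℕ.n<1+n n)))) ⟩
      sum n (λ k → (n C k) ⋅ t k) + 0#
        ≈⟨ +-identityʳ _ ⟩
      sum n (λ k → (n C k) ⋅ t k) ∎

  infixl 7 _⋆_
  _⋆_ : Seq → Seq → Seq
  (f ⋆ g) n = sum n (λ k → (n C k) ⋅ (f (n ∸ k) * g k))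

  shift : Seq → Seq
  shift f m = f (suc m)

  ⋆-cong : ∀ {f f′ g g′ : Seq} → (∀ k → f k ≈ f′ k) → (∀ k → g k ≈ g′ k) →
           ∀ n → (f ⋆ g) n ≈ (f′ ⋆ g′) n
  ⋆-cong f≈f′ g≈g′ n = sum-cong′ n (λ k → ×-congʳ (n C k) (*-cong (f≈f′ (n ∸ k)) (g≈g′ k)))

  ⋆-distribˡ : ∀ n (f g g′ : Seq) → (f ⋆ (λ k → g k + g′ k)) n ≈ (f ⋆ g) n + (f ⋆ g′) n
  ⋆-distribˡ n f g g′ = trans
    (sum-cong′ n (λ k → trans (×-congʳ (n C k) (distribˡ _ _ _)) (×-distrib-+ _ _ (n C k))))
    (sum-+ n _ _)

  ⋆-distribʳ : ∀ n (f f′ g : Seq) → ((λ k → f k + f′ k) ⋆ g) n ≈ (f ⋆ g) n + (f′ ⋆ g) n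
  ⋆-distribʳ n f f′ g = trans
    (sum-cong′ n (λ k → trans (×-congʳ (n C k) (distribʳ _ _ _)) (×-distrib-+ _ _ (n C k))))
    (sum-+ n _ _)

  ⋆-scaleʳ : ∀ n e (f g : Seq) → (f ⋆ (λ k → e * g k)) n ≈ e * (f ⋆ g) n
  ⋆-scaleʳ n e f g = trans
    (sum-cong′ n (λ k → trans (×-congʳ (n C k) (*-leftComm _ e _)) (sym (×-comm-* (n C k) e _))))
    (sym (sum-*ˡ n e _))

  -- Leibniz rule: the shift is a derivation for ⋆ (this is Pascal's rule).
  leibniz : ∀ n (f g : Seq) → (f ⋆ g) (suc n) ≈ (shift f ⋆ g) n + (f ⋆ shift g) n
  leibniz n f g = trans (sum-pascal n (λ k → f (suc n ∸ k) * g k))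
    (+-congʳ (sum-cong n (λ k k≤n →
      ×-congʳ (n C k) (*-congʳ (reflexive (≡.cong f (ℕ.+-∸-assoc 1 k≤n)))))))

  ⋆-assoc : ∀ n (f g h : Seq) → (f ⋆ (g ⋆ h)) n ≈ ((f ⋆ g) ⋆ h) n
  ⋆-assoc zero f g h = begin
    1 ⋅ (f 0 * (1 ⋅ (g 0 * h 0))) ≈⟨ ×-homo-1 _ ⟩
    f 0 * (1 ⋅ (g 0 * h 0))       ≈⟨ *-congˡ (×-homo-1 _) ⟩
    f 0 * (g 0 * h 0)             ≈⟨ *-assoc _ _ _ ⟨
    (f 0 * g 0) * h 0             ≈⟨ *-congʳ (×-homo-1 _) ⟨
    (1 ⋅ (f 0 * g 0)) * h 0       ≈⟨ ×-homo-1 _ ⟨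
    1 ⋅ ((1 ⋅ (f 0 * g 0)) * h 0) ∎
  ⋆-assoc (suc n) f g h = begin
    (f ⋆ (g ⋆ h)) (suc n)
      ≈⟨ leibniz n f (g ⋆ h) ⟩
    (f′ ⋆ (g ⋆ h)) n + (f ⋆ shift (g ⋆ h)) n
      ≈⟨ +-congˡ (⋆-cong {f} (λ _ → refl) (λ m → leibniz m g h) n) ⟩
    (f′ ⋆ (g ⋆ h)) n + (f ⋆ (λ m → (g′ ⋆ h) m + (g ⋆ h′) m)) n
      ≈⟨ +-congˡ (⋆-distribˡ n f _ _) ⟩
    (f′ ⋆ (g ⋆ h)) n + ((f ⋆ (g′ ⋆ h)) n + (f ⋆ (g ⋆ h′)) n)
      ≈⟨ +-cong (⋆-assoc n f′ g h) (+-cong (⋆-assoc n f g′ h) (⋆-assoc n f g h′)) ⟩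
    ((f′ ⋆ g) ⋆ h) n + (((f ⋆ g′) ⋆ h) n + ((f ⋆ g) ⋆ h′) n)
      ≈⟨ +-assoc _ _ _ ⟨
    (((f′ ⋆ g) ⋆ h) n + ((f ⋆ g′) ⋆ h) n) + ((f ⋆ g) ⋆ h′) n
      ≈⟨ +-congʳ (⋆-distribʳ n (f′ ⋆ g) (f ⋆ g′) h) ⟨
    ((λ m → (f′ ⋆ g) m + (f ⋆ g′) m) ⋆ h) n + ((f ⋆ g) ⋆ h′) n
      ≈⟨ +-congʳ (⋆-cong {g = h} (λ m → leibniz m f g) (λ _ → refl) n) ⟨
    (shift (f ⋆ g) ⋆ h) n + ((f ⋆ g) ⋆ h′) n
      ≈⟨ leibniz n (f ⋆ g) h ⟨
    ((f ⋆ g) ⋆ h) (suc n) ∎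
    where
    f′ g′ h′ : Seq
    f′ = shift f
    g′ = shift g
    h′ = shift h

  sign : ℕ → Carrier
  sign = negOnePow R

  sign-+ : ∀ a b → sign (a ℕ.+ b) ≈ sign a * sign b
  sign-+ zero    b = sym (*-identityˡ _)
  sign-+ (suc a) b = trans (*-congˡ (sign-+ a b)) (sym (*-assoc _ _ _))

  sign-2+ : ∀ n → sign (suc (suc n)) ≈ sign n
  sign-2+ n = begin
    - 1# * (- 1# * sign n) ≈⟨ *-assoc _ _ _ ⟨
    (- 1# * - 1#) * sign n ≈⟨ *-congʳ (trans (-1*x≈-x (- 1#)) (-‿involutive 1#)) ⟩
    1# * sign n            ≈⟨ *-identityˡ _ ⟩
    sign n                 ∎

  sign-even : ∀ n → n % 2 ≡ 0 → sign n ≈ 1#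
  sign-even zero          _    = refl
  sign-even (suc (suc n)) even = trans (sign-2+ n) (sign-even n even)

  sign-odd : ∀ n → n % 2 ≡ 1 → sign n ≈ - 1#
  sign-odd (suc zero)    _   = *-identityʳ _
  sign-odd (suc (suc n)) odd = trans (sign-2+ n) (sign-odd n odd)

  twist : Seq → Seq
  twist f k = sign k * f k

  twist-⋆ : ∀ n (f g : Seq) → (twist f ⋆ twist g) n ≈ sign n * (f ⋆ g) n
  twist-⋆ n f g = trans (sum-cong n term) (sym (sum-*ˡ n (sign n) _))
    where
    term : ∀ k → k ≤ n → (n C k) ⋅ (twist f (n ∸ k) * twist g k)
                           ≈ sign n * ((n C k) ⋅ (f (n ∸ k) * g k))
    term k k≤n = begin
      (n C k) ⋅ ((sign (n ∸ k) * f (n ∸ k)) * (sign k * g k))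
        ≈⟨ ×-congʳ (n C k) (*-interchange _ _ _ _) ⟩
      (n C k) ⋅ ((sign (n ∸ k) * sign k) * (f (n ∸ k) * g k))
        ≈⟨ ×-congʳ (n C k) (*-congʳ (sym (sign-+ (n ∸ k) k))) ⟩
      (n C k) ⋅ (sign (n ∸ k ℕ.+ k) * (f (n ∸ k) * g k))
        ≈⟨ ×-congʳ (n C k) (*-congʳ (reflexive (≡.cong sign (ℕ.m∸n+n≡m k≤n)))) ⟩
      (n C k) ⋅ (sign n * (f (n ∸ k) * g k))
        ≈⟨ ×-comm-* (n C k) _ _ ⟨
      sign n * ((n C k) ⋅ (f (n ∸ k) * g k)) ∎

  ones : Seq
  ones _ = 1#

  binomNegSum≈ones⋆twist : ∀ (A : Seq) k → binomNegSum R A k ≈ (ones ⋆ twist A) k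
  binomNegSum≈ones⋆twist A k = sum-cong′ k (λ j →
    trans (·≈⋅ (k C j) _) (×-congʳ (k C j) (sym (*-identityˡ _))))

  VanishingTriples : Seq → Set ℓ
  VanishingTriples f = ∀ x → f x + (f (suc x) + f (suc (suc x))) ≈ 0#

  -- For such f, (f ⋆ 1)(m) = (-1)^m f(2m): by Leibniz, (f ⋆ 1)(m+1) is
  -- (-1)^m (f(2m+1) + f(2m)) = -(-1)^m f(2m+2).
  ⋆ones-of-vanishingTriples : ∀ (f : Seq) → VanishingTriples f →
    ∀ m → (f ⋆ ones) m ≈ sign m * f (m ℕ.+ m)
  ⋆ones-of-vanishingTriples f triples zero =
    trans (×-homo-1 _) (trans (*-identityʳ _) (sym (*-identityˡ _)))
  ⋆ones-of-vanishingTriples f triples (suc m) = begin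
    (f ⋆ ones) (suc m)
      ≈⟨ leibniz m f ones ⟩
    (shift f ⋆ ones) m + (f ⋆ ones) m
      ≈⟨ +-cong (⋆ones-of-vanishingTriples (shift f) (λ x → triples (suc x)) m)
                (⋆ones-of-vanishingTriples f triples m) ⟩
    sign m * f (suc (m ℕ.+ m)) + sign m * f (m ℕ.+ m)
      ≈⟨ distribˡ _ _ _ ⟨
    sign m * (f (suc (m ℕ.+ m)) + f (m ℕ.+ m))
      ≈⟨ *-congˡ (trans (+-comm _ _) pair≈-third) ⟩
    sign m * - f (suc (suc (m ℕ.+ m)))
      ≈⟨ trans (sym (-‿distribʳ-* _ _)) (-‿distribˡ-* _ _) ⟩
    - sign m * f (suc (suc (m ℕ.+ m)))
      ≈⟨ *-cong (sym (-1*x≈-x _)) (reflexive (≡.cong f (≡.cong suc (≡.sym (ℕ.+-suc m m))))) ⟩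
    sign (suc m) * f (suc m ℕ.+ suc m) ∎
    where
    pair≈-third : f (m ℕ.+ m) + f (suc (m ℕ.+ m)) ≈ - f (suc (suc (m ℕ.+ m)))
    pair≈-third = +-inverseˡ-unique _ _ (trans (+-assoc _ _ _) (triples (m ℕ.+ m)))

  χ : Seq
  χ zero                   = 1# + 1#
  χ (suc zero)             = - 1#
  χ (suc (suc zero))       = - 1#
  χ (suc (suc (suc m)))    = χ m

  χ-vanishingTriples : VanishingTriples χ
  χ-vanishingTriples zero                = 2-1-1≈0
    where
    2-1-1≈0 : (1# + 1#) + (- 1# + - 1#) ≈ 0#
    2-1-1≈0 = trans (+-interchange _ _ _ _)
      (trans (+-cong (-‿inverseʳ 1#) (-‿inverseʳ 1#)) (+-identityʳ 0#))
  χ-vanishingTriples (suc zero)          =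
    trans (sym (+-assoc _ _ _)) (trans (+-comm _ _) (χ-vanishingTriples 0))
  χ-vanishingTriples (suc (suc zero))    =
    trans (+-comm _ _) (trans (+-assoc _ _ _) (χ-vanishingTriples 0))
  χ-vanishingTriples (suc (suc (suc x))) = χ-vanishingTriples x

  -- χ(2m) = χ(m), since 2m ≡ -m (mod 3).
  χ-double : ∀ m → χ (m ℕ.+ m) ≡ χ m
  χ-double zero                = ≡.refl
  χ-double (suc zero)          = ≡.refl
  χ-double (suc (suc zero))    = ≡.refl
  χ-double (suc (suc (suc m))) = ≡.trans (≡.cong χ m+[m+3]≡[m+m]+3) (χ-double m)
    where
    m+[m+3]≡[m+m]+3 : m ℕ.+ suc (suc (suc m)) ≡ suc (suc (suc (m ℕ.+ m)))
    m+[m+3]≡[m+m]+3 = ℕ.+-comm m (suc (suc (suc m)))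

  χ-spec : ∀ m → (3 ∣ m × χ m ≡ 1# + 1#) ⊎ (¬ 3 ∣ m × χ m ≡ - 1#)
  χ-spec zero                = inj₁ (3 ∣0 , ≡.refl)
  χ-spec (suc zero)          = inj₂ ((λ 3∣1 → 3≰1 (∣⇒≤ 3∣1)) , ≡.refl)
    where
    3≰1 : ¬ (3 ≤ 1)
    3≰1 (s≤s ())
  χ-spec (suc (suc zero))    = inj₂ ((λ 3∣2 → 3≰2 (∣⇒≤ 3∣2)) , ≡.refl)
    where
    3≰2 : ¬ (3 ≤ 2)
    3≰2 (s≤s (s≤s ()))
  χ-spec (suc (suc (suc m))) with χ-spec m
  ... | inj₁ (3∣m , χm)  = inj₁ (∣m∣n⇒∣m+n {m = 3} ∣-refl 3∣m , χm)
  ... | inj₂ (3∤m , χm)  = inj₂ ((λ 3∣m+3 → 3∤m (∣m+n∣m⇒∣n {m = 3} 3∣m+3 ∣-refl)) , χm)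

  χ-indicator : ∀ m y → χ m * y + y ≈ (3 ⋅ 1#) * if3∣ R m y
  χ-indicator m y with 3 ∣? m | χ-spec m
  ... | yes 3∣m | inj₂ (3∤m , _) = ⊥-elim (3∤m 3∣m)
  ... | no 3∤m  | inj₁ (3∣m , _) = ⊥-elim (3∤m 3∣m)
  ... | yes _   | inj₁ (_ , χm≡2) = begin
    χ m * y + y         ≈⟨ +-congʳ (*-congʳ (reflexive χm≡2)) ⟩
    (1# + 1#) * y + y   ≈⟨ +-congʳ (trans (distribʳ y 1# 1#) (+-cong (*-identityˡ y) (*-identityˡ y))) ⟩
    (y + y) + y         ≈⟨ trans (+-assoc y y y) (+-congˡ (+-congˡ (sym (+-identityʳ y)))) ⟩
    3 ⋅ y               ≈⟨ ⋅1#-* 3 y ⟨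
    (3 ⋅ 1#) * y        ∎
  ... | no _    | inj₂ (_ , χm≡-1) = begin
    χ m * y + y         ≈⟨ +-congʳ (trans (*-congʳ (reflexive χm≡-1)) (-1*x≈-x y)) ⟩
    - y + y             ≈⟨ -‿inverseˡ y ⟩
    0#                  ≈⟨ zeroʳ _ ⟨
    (3 ⋅ 1#) * 0#       ∎

  χ⋆ones≈twistχ : ∀ m → (χ ⋆ ones) m ≈ twist χ m
  χ⋆ones≈twistχ m = trans (⋆ones-of-vanishingTriples χ χ-vanishingTriples m)
                          (*-congˡ (reflexive (χ-double m)))

  χ⋆-vanishes : ∀ {y} → (2 ⋅ 1#) * y ≈ 1# → ∀ e (A : Seq) n →
    (∀ k → A k ≈ e * (ones ⋆ twist A) k) → e * sign n ≈ - 1# → (χ ⋆ A) n ≈ 0#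
  χ⋆-vanishes 2y≈1 e A n A≈e[1⋆twistA] e[-1]ⁿ≈-1 = self-negative⇒0 2y≈1 (begin
    T                                   ≈⟨ ⋆-cong {χ} (λ _ → refl) A≈e[1⋆twistA] n ⟩
    (χ ⋆ (λ k → e * (ones ⋆ twist A) k)) n ≈⟨ ⋆-scaleʳ n e χ _ ⟩
    e * (χ ⋆ (ones ⋆ twist A)) n        ≈⟨ *-congˡ (⋆-assoc n χ ones (twist A)) ⟩
    e * ((χ ⋆ ones) ⋆ twist A) n        ≈⟨ *-congˡ (⋆-cong {g = twist A} χ⋆ones≈twistχ (λ _ → refl) n) ⟩
    e * (twist χ ⋆ twist A) n           ≈⟨ *-congˡ (twist-⋆ n χ A) ⟩
    e * (sign n * T)                    ≈⟨ *-assoc _ _ _ ⟨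
    (e * sign n) * T                    ≈⟨ *-congʳ e[-1]ⁿ≈-1 ⟩
    - 1# * T                            ≈⟨ -1*x≈-x T ⟩
    - T                                 ∎)
    where
    T : Carrier
    T = (χ ⋆ A) n

  signed-eigen : ∀ (A : Seq) n → (IsEvenSeq R A × n % 2 ≡ 1) ⊎ (IsOddSeq R A × n % 2 ≡ 0) →
    Σ Carrier λ e → (∀ k → A k ≈ e * (ones ⋆ twist A) k) × e * sign n ≈ - 1#
  signed-eigen A n (inj₁ (even , n-odd)) =
    1# , (λ k → trans (sym (even k)) (trans (binomNegSum≈ones⋆twist A k) (sym (*-identityˡ _))))
       , trans (*-identityˡ _) (sign-odd n n-odd)
  signed-eigen A n (inj₂ (odd , n-even)) =
    - 1# , (λ k → begin
             A k                          ≈⟨ -‿involutive (A k) ⟨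
             - - A k                      ≈⟨ -‿cong (odd k) ⟨
             - binomNegSum R A k          ≈⟨ -‿cong (binomNegSum≈ones⋆twist A k) ⟩
             - (ones ⋆ twist A) k         ≈⟨ -1*x≈-x _ ⟨
             - 1# * (ones ⋆ twist A) k    ∎)
         , trans (*-congˡ (sign-even n n-even)) (*-identityʳ _)

  restricted-sum-reflect : ∀ (A : Seq) n →
    sum n (λ k → if3∣ R k (_·_ R (n C k) (A (n ∸ k))))
      ≈ sum n (λ k → if3∣ R (n ∸ k) (_·_ R (n C k) (A k)))
  restricted-sum-reflect A n = trans (sum-reverse n _) (sum-cong n (λ k k≤n → reflexive
    (≡.cong₂ (λ i j → if3∣ R (n ∸ k) (_·_ R i (A j)))
             (≡.sym (nCk≡nC[n∸k] k≤n)) (ℕ.m∸[m∸n]≡n k≤n))))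

  three-restricted-sum : ∀ (A : Seq) n →
    (3 ⋅ 1#) * sum n (λ k → if3∣ R (n ∸ k) (_·_ R (n C k) (A k)))
      ≈ (χ ⋆ A) n + sum n (λ k → _·_ R (n C k) (A k))
  three-restricted-sum A n = begin
    (3 ⋅ 1#) * sum n (λ k → if3∣ R (n ∸ k) (b k))
      ≈⟨ sum-*ˡ n _ _ ⟩
    sum n (λ k → (3 ⋅ 1#) * if3∣ R (n ∸ k) (b k))
      ≈⟨ sum-cong′ n (λ k → χ-indicator (n ∸ k) (b k)) ⟨
    sum n (λ k → χ (n ∸ k) * b k + b k)
      ≈⟨ sum-+ n _ b ⟩
    sum n (λ k → χ (n ∸ k) * b k) + sum n b
      ≈⟨ +-congʳ (sum-cong′ n (λ k → trans (*-congˡ (·≈⋅ (n C k) (A k))) (×-comm-* (n C k) _ _))) ⟩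
    (χ ⋆ A) n + sum n b ∎
    where
    b : Seq
    b k = _·_ R (n C k) (A k)

theorem3p1 : {c ℓ : Level} (R : CommutativeRing c ℓ) (inv : QAlgebraInverses R)
    (A : ℕ → CommutativeRing.Carrier R) (n : ℕ) → 1 ≤ n →
    (IsEvenSeq R A × n % 2 ≡ 1) ⊎ (IsOddSeq R A × n % 2 ≡ 0) →
    let open CommutativeRing R in
    (sumTo R n (λ k → if3∣ R k (_·_ R (n C k) (A (n ∸ k))))
      ≈ sumTo R n (λ k → if3∣ R (n ∸ k) (_·_ R (n C k) (A k))))
    × (sumTo R n (λ k → if3∣ R (n ∸ k) (_·_ R (n C k) (A k)))
      ≈ proj₁ (inv 2) * sumTo R n (λ k → _·_ R (n C k) (A k)))
theorem3p1 R inv A n _ parity =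
  restricted-sum-reflect A n ,
  divide 3 (proj₂ (inv 2)) (begin
    (3 ⋅ 1#) * sum n (λ k → if3∣ R (n ∸ k) (_·_ R (n C k) (A k)))
      ≈⟨ three-restricted-sum A n ⟩
    (χ ⋆ A) n + sum n (λ k → _·_ R (n C k) (A k))
      ≈⟨ +-congʳ (χ⋆-vanishes (proj₂ (inv 1)) e A n A≈e[1⋆twistA] e[-1]ⁿ≈-1) ⟩
    0# + sum n (λ k → _·_ R (n C k) (A k))
      ≈⟨ +-identityˡ _ ⟩
    sum n (λ k → _·_ R (n C k) (A k)) ∎)
  where
  open CommutativeRing R
  open import Relation.Binary.Reasoning.Setoid setoid
  open import Algebra.Properties.Semiring.Mult semiring using () renaming (_×_ to _⋅_)
  open BinomialConvolution R
  e : Carrier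
  e = proj₁ (signed-eigen A n parity)
  A≈e[1⋆twistA] : ∀ k → A k ≈ e * (ones ⋆ twist A) k
  A≈e[1⋆twistA] = proj₁ (proj₂ (signed-eigen A n parity))
  e[-1]ⁿ≈-1 : e * sign n ≈ - 1#
  e[-1]ⁿ≈-1 = proj₂ (proj₂ (signed-eigen A n parity))
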